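{- Let an instance of $(1 \mid p\mathrm{MA} \mid \sum_j C_j)$ be given with jobs $J_1,\dots,J_n$ and initial level $\mathrm{ML}_0$. Let $\pi=(\pi_1,\dots,\pi_n)$ be an optimal schedule (i.e. a feasible schedule of minimum total completion time) which, for each $i=1,\dots,n$, has total maintenance duration before the start of $J_{\pi_i}$ equal to $\max\{0,\sum_{j=1}^i\delta_{\pi_j}-\mathrm{ML}_0\}$. Suppose $J_{\pi_k}$ is the separation job of $\pi$, and let $\delta=\mathrm{ML}_0-\sum_{i=1}^{k-1}\delta_{\pi_i}$ be the remaining maintenance level before the first MA. Then: (i) $p_{\pi_1}\le p_{\pi_2}\le\dots\le p_{\pi_{k-1}}$; (ii) $p_{\pi_{k+1}}+\delta_{\pi_{k+1}}\le p_{\pi_{k+2}}+\delta_{\pi_{k+2}}\le\dots\le p_{\pi_n}+\delta_{\pi_n}$; (iii) if $k\ge 2$, then $p_{\pi_{k-1}}+\min\{\delta_{\pi_{k-1}},\delta_{\pi_k}-\delta\}\le p_{\pi_k}+(\delta_{\pi_k}-\delta)$, and if $k\le n-1$, then $p_{\pi_k}+(\delta_{\pi_k}-\delta)\le p_{\pi_{k+1}}+\max\{0,\delta_{\pi_{k+1}}-\delta\}$.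
   Context: Problem $(1 \mid p\mathrm{MA} \mid \sum_j C_j)$: A single machine has a maintenance level $\mathrm{ML}$, initially $\mathrm{ML}_0$, and a maximum maintenance level $\mathrm{ML}^{\max}\ge\mathrm{ML}_0\ge 0$. Each job $J_i=(p_i,\delta_i)$ has a non-preemptive processing time $p_i$ and a machine deterioration $\delta_i$: processing $J_i$ when the level is $\mathrm{ML}$ leaves the level $\mathrm{ML}-\delta_i$. The level must be non-negative at all times. A schedule processes all jobs one at a time, non-preemptively, and may interleave maintenance activities (MAs); an MA of duration $D$ occupies the machine for time $D$ and raises the level from $\mathrm{ML}$ to $\mathrm{ML}+\min\{D,\mathrm{ML}^{\max}-\mathrm{ML}\}$, with duration any value in $[0,\mathrm{ML}^{\max}-\mathrm{ML}]$ (partial maintenance). Feasible means the level is never negative; the objective is the total completion time $\sum_iC_i$. A schedule is identified with the permutation $\pi=(\pi_1,\dots,\pi_n)$ giving the order in which jobs are processed. The separation job of such a schedule is the first job that requires an MA of positive duration, i.e. $J_{\pi_k}$ with $k$ the smallest index such that $\sum_{j=1}^k\delta_{\pi_j}>\mathrm{ML}_0$ (assumed to exist).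
   Formalization: The processing times $p_i$, the deteriorations $\delta_i$, the levels $\mathrm{ML}_0$ and $\mathrm{ML}^{\max}$, and all maintenance durations are taken to be rational. -}

module Defs where

open import Data.Nat using (ℕ; suc)
open import Data.Fin using (Fin; toℕ)
open import Data.List using (List; []; _∷_; map; take; sum; foldr)
open import Data.List.Base using (allFin)
open import Data.Product using (_×_; _,_)
open import Data.Unit using (⊤)
open import Relation.Binary.PropositionalEquality using (_≡_)
import Data.Nat as N
open import Data.Rational using (ℚ; 0ℚ; _+_; _-_; _≤_; _<_; _⊔_; _⊓_)
open import Data.Fin.Permutation using (Permutation′; _⟨$⟩ʳ_)

record Instance (n : ℕ) : Set where
  field
    p      : Fin n → ℚ
    δ      : Fin n → ℚ
    ML₀    : ℚ
    MLmax  : ℚ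
    p≥0    : ∀ i → 0ℚ ≤ p i
    δ≥0    : ∀ i → 0ℚ ≤ δ i
    ML₀≥0  : 0ℚ ≤ ML₀
    ML₀≤max : ML₀ ≤ MLmax

-- A schedule: the processing order π (position ↦ job) together with the
-- duration m i of the (possibly zero) maintenance activity performed
-- immediately before the job at position i.  (Consecutive MAs can be merged
-- into one, and an MA after the last job affects nothing, so this captures
-- all schedules.)
record Schedule (n : ℕ) : Set where
  field
    π : Permutation′ n
    m : Fin n → ℚ

module _ {n : ℕ} (I : Instance n) where
  open Instance I

  steps : Schedule n → List (ℚ × Fin n)
  steps S = map (λ i → (Schedule.m S i , Schedule.π S ⟨$⟩ʳ i)) (allFin n)

  feasibleFrom : ℚ → List (ℚ × Fin n) → Set
  feasibleFrom L [] = ⊤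
  feasibleFrom L ((d , j) ∷ rest) =
    (0ℚ ≤ d) × (d ≤ MLmax - L) × (0ℚ ≤ (L + d) - δ j)
      × feasibleFrom ((L + d) - δ j) rest

  Feasible : Schedule n → Set
  Feasible S = feasibleFrom ML₀ (steps S)

  sumCFrom : ℚ → List (ℚ × Fin n) → ℚ
  sumCFrom t [] = 0ℚ
  sumCFrom t ((d , j) ∷ rest) = ((t + d) + p j) + sumCFrom ((t + d) + p j) rest

  TotalCompletion : Schedule n → ℚ
  TotalCompletion S = sumCFrom 0ℚ (steps S)

  Optimal : Schedule n → Set
  Optimal S = Feasible S × (∀ S′ → Feasible S′ → TotalCompletion S ≤ TotalCompletion S′)

  sumℚ : List ℚ → ℚ
  sumℚ = foldr _+_ 0ℚ

  module _ (S : Schedule n) where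
    P : Fin n → ℚ
    P i = p (Schedule.π S ⟨$⟩ʳ i)

    Δ : Fin n → ℚ
    Δ i = δ (Schedule.π S ⟨$⟩ʳ i)

    -- Σ_{positions j ≤ i} f j   (i.e. positions 1..i+1 in 1-based indexing)
    prefixUpTo : (Fin n → ℚ) → Fin n → ℚ
    prefixUpTo f i = sumℚ (take (suc (toℕ i)) (map f (allFin n)))

    prefixBefore : (Fin n → ℚ) → Fin n → ℚ
    prefixBefore f i = sumℚ (take (toℕ i) (map f (allFin n)))

    MinimalMaintenance : Set
    MinimalMaintenance =
      ∀ i → prefixUpTo (Schedule.m S) i ≡ (0ℚ ⊔ (prefixUpTo Δ i - ML₀))

    IsSeparation : Fin n → Set
    IsSeparation k =
      (ML₀ < prefixUpTo Δ k) × (∀ j → toℕ j N.< toℕ k → prefixUpTo Δ j ≤ ML₀)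

-- Adjacent interchange.  Take jobs a and a+1 of a feasible schedule, entered at maintenance
-- level L.  Swap them, maintain only the shortfall 0 ⊔ (δ_{a+1} - L) before job a+1, and do the
-- rest of the pair's maintenance before job a.  The pair then ends at the same time and level,
-- and the new schedule is feasible provided the old maintenance before job a+1 did not exceed
-- δ_{a+1}.  Optimality therefore gives, for every adjacent pair,
--   p_a + m_a ≤ p_{a+1} + 0 ⊔ (δ_{a+1} - L_a).
-- Under minimal maintenance m_a ≤ δ_a always holds, and (L_a , m_a) is explicit: it is
-- (ML₀ - Σ_{j<a} δ_j , 0) before the separation job k, (δ , δ_k - δ) at k and (0 , δ_a) after k.
-- Substituting these into the inequality above gives (i)-(iv).
module Submission where

open import Defs
open import Data.Nat using (ℕ; suc; zero; z≤n; s≤s; _∸_)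
import Data.Nat as N
import Data.Nat.Properties as ℕ
open import Data.Fin using (Fin; toℕ; zero; suc; fromℕ<)
open import Data.Fin.Properties using (_≟_; toℕ-fromℕ<; toℕ-injective; toℕ<n; suc-injective)
open import Data.Fin.Permutation using (_⟨$⟩ʳ_; transpose; _∘ₚ_)
import Data.Fin.Permutation.Components as Components
open import Data.List using (List; []; _∷_; _++_; map; take; tabulate; foldr; allFin)
open import Data.List.Properties using (tabulate-cong; map-tabulate)
open import Data.Product using (_×_; _,_; proj₁; proj₂; ∃-syntax)
open import Data.Rational using (ℚ; 0ℚ; _+_; _-_; _≤_; _<_; _⊔_; _⊓_)
import Data.Rational as ℚ
open import Data.Rational.Properties
  using ( ≤-refl; ≤-trans; ≤-reflexive; ≤-total; <-irrefl; <-≤-trans; <⇒≤; ≮⇒≥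
        ; +-assoc; +-comm; +-identityˡ; +-identityʳ; +-inverseʳ
        ; +-monoˡ-≤; +-monoʳ-≤; +-mono-<-≤; +-monoʳ-<
        ; p≤p⊔q; p≤q⊔p; ⊔-lub; mono-≤-distrib-⊔
        ; p≤q⇒p⊔q≡q; p≥q⇒p⊔q≡p; p≤q⇒p⊓q≡p; p≥q⇒p⊓q≡q
        ; module ≤-Reasoning )
open import Data.Rational.Solver using (module +-*-Solver)
open import Data.Sum using (inj₁; inj₂)
open import Data.Vec.Functional using (updateAt)
open import Data.Vec.Functional.Properties using (updateAt-updates; updateAt-minimal)
open import Function using (_∘_; id; const)
open import Relation.Binary.PropositionalEquality
  using (_≡_; _≢_; refl; sym; trans; cong; cong₂; subst; subst₂; module ≡-Reasoning)
open import Relation.Nullary using (¬_; yes; no)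
open import Relation.Nullary.Decidable using (dec-true; dec-false)

open +-*-Solver

p≤q⇒0≤q-p : ∀ {p q} → p ≤ q → 0ℚ ≤ q - p
p≤q⇒0≤q-p {p} {q} p≤q = subst (_≤ q - p) (+-inverseʳ p) (+-monoˡ-≤ (ℚ.- p) p≤q)

0≤q-p⇒p≤q : ∀ {p q} → 0ℚ ≤ q - p → p ≤ q
0≤q-p⇒p≤q {p} {q} 0≤q-p =
  subst₂ _≤_ (+-identityˡ p) (solve 2 (λ p q → (q :- p) :+ p := q) refl p q) (+-monoˡ-≤ p 0≤q-p)

p≤p+q : ∀ {p q} → 0ℚ ≤ q → p ≤ p + q
p≤p+q {p} {q} 0≤q = subst (_≤ p + q) (+-identityʳ p) (+-monoʳ-≤ p 0≤q)

0≤p+q : ∀ {p q} → 0ℚ ≤ p → 0ℚ ≤ q → 0ℚ ≤ p + q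
0≤p+q 0≤p 0≤q = ≤-trans 0≤p (p≤p+q 0≤q)

≤-by-difference : ∀ {p q r s} → q - p ≡ s - r → p ≤ q → r ≤ s
≤-by-difference same p≤q = 0≤q-p⇒p≤q (subst (0ℚ ≤_) same (p≤q⇒0≤q-p p≤q))

p≤q⇒p-q≤0 : ∀ {p q} → p ≤ q → p - q ≤ 0ℚ
p≤q⇒p-q≤0 {p} {q} = ≤-by-difference (solve 2 (λ p q → q :- p := con 0ℚ :- (p :- q)) refl p q)

q+p≤r⇒p≤r-q : ∀ {p q r} → q + p ≤ r → p ≤ r - q
q+p≤r⇒p≤r-q {p} {q} {r} = ≤-by-difference (solve 3 (λ p q r → r :- (q :+ p) := (r :- q) :- p) refl p q r)

p≤r-q⇒q+p≤r : ∀ {p q r} → p ≤ r - q → q + p ≤ r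
p≤r-q⇒q+p≤r {p} {q} {r} = ≤-by-difference (solve 3 (λ p q r → (r :- q) :- p := r :- (q :+ p)) refl p q r)

p≤q+r⇒p-q≤r : ∀ {p q r} → p ≤ q + r → p - q ≤ r
p≤q+r⇒p-q≤r {p} {q} {r} = ≤-by-difference (solve 3 (λ p q r → (q :+ r) :- p := r :- (p :- q)) refl p q r)

p-q≤p : ∀ {p q} → 0ℚ ≤ q → p - q ≤ p
p-q≤p {p} {q} 0≤q = p≤q+r⇒p-q≤r (subst (p ≤_) (+-comm p q) (p≤p+q 0≤q))

shortfall : ℚ → ℚ → ℚ
shortfall L d = 0ℚ ⊔ (d - L)

+-shortfall : ∀ L d → L + shortfall L d ≡ L ⊔ d
+-shortfall L d =
  trans (mono-≤-distrib-⊔ (+-monoʳ-≤ L) 0ℚ (d - L))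
        (cong₂ _⊔_ (+-identityʳ L) (solve 2 (λ L d → L :+ (d :- L) := d) refl L d))

shortfall-≤ : ∀ {L d} → d ≤ L → shortfall L d ≡ 0ℚ
shortfall-≤ d≤L = p≥q⇒p⊔q≡p (p≤q⇒p-q≤0 d≤L)

shortfall-≥ : ∀ {L d} → L ≤ d → shortfall L d ≡ d - L
shortfall-≥ L≤d = p≤q⇒p⊔q≡q (p≤q⇒0≤q-p L≤d)

shortfall-+-⊓ : ∀ L d → shortfall L d + (L ⊓ d) ≡ d
shortfall-+-⊓ L d with ≤-total L d
... | inj₁ L≤d = trans (cong₂ _+_ (shortfall-≥ L≤d) (p≤q⇒p⊓q≡p L≤d))
                       (solve 2 (λ L d → (d :- L) :+ L := d) refl L d)
... | inj₂ d≤L = trans (cong₂ _+_ (shortfall-≤ d≤L) (p≥q⇒p⊓q≡q d≤L)) (+-identityˡ d)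

shortfall-+ : ∀ L s {e} → 0ℚ ≤ e → shortfall L (s + e) ≤ shortfall L s + e
shortfall-+ L s {e} 0≤e = ⊔-lub (0≤p+q (p≤p⊔q 0ℚ (s - L)) 0≤e)
  (subst (_≤ shortfall L s + e) (solve 3 (λ L s e → (s :- L) :+ e := (s :+ e) :- L) refl L s e)
         (+-monoˡ-≤ e (p≤q⊔p 0ℚ (s - L))))

prefixSum : ∀ {N} → (Fin N → ℚ) → ℕ → ℚ
prefixSum f j = foldr _+_ 0ℚ (take j (tabulate f))

prefixSum-suc : ∀ {N} (f : Fin N → ℚ) x → prefixSum f (suc (toℕ x)) ≡ prefixSum f (toℕ x) + f x
prefixSum-suc f zero = +-comm (f zero) 0ℚ
prefixSum-suc f (suc x) =
  trans (cong (f zero +_) (prefixSum-suc (f ∘ suc) x)) (sym (+-assoc (f zero) _ _))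

prefixSum-nonneg : ∀ {N} (f : Fin N → ℚ) → (∀ x → 0ℚ ≤ f x) → ∀ j → 0ℚ ≤ prefixSum f j
prefixSum-nonneg f 0≤f zero = ≤-refl
prefixSum-nonneg {zero} f 0≤f (suc j) = ≤-refl
prefixSum-nonneg {suc N} f 0≤f (suc j) = 0≤p+q (0≤f zero) (prefixSum-nonneg (f ∘ suc) (0≤f ∘ suc) j)

prefixSum-mono : ∀ {N} (f : Fin N → ℚ) → (∀ x → 0ℚ ≤ f x) →
                 ∀ {i j} → i N.≤ j → prefixSum f i ≤ prefixSum f j
prefixSum-mono f 0≤f {zero} {j} _ = prefixSum-nonneg f 0≤f j
prefixSum-mono {zero} f 0≤f {suc i} (s≤s _) = ≤-refl
prefixSum-mono {suc N} f 0≤f {suc i} (s≤s i≤j) = +-monoʳ-≤ (f zero) (prefixSum-mono (f ∘ suc) (0≤f ∘ suc) i≤j)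

∀-toℕ : ∀ {N} {P : ℕ → Set} → (∀ (x : Fin N) → P (toℕ x)) → ∀ {j} → j N.< N → P j
∀-toℕ {P = P} Px j<N = subst P (toℕ-fromℕ< j<N) (Px (fromℕ< j<N))

monotone-from-adjacent : ∀ {N} (f : Fin N → ℚ) (lo hi : ℕ) →
  (∀ a b → suc (toℕ a) ≡ toℕ b → lo N.≤ toℕ a → toℕ b N.< hi → f a ≤ f b) →
  ∀ i j → lo N.≤ toℕ i → toℕ i N.≤ toℕ j → toℕ j N.< hi → f i ≤ f j
monotone-from-adjacent {N} f lo hi adjacent i j lo≤i i≤j =
  go (toℕ j ∸ toℕ i) j (sym (ℕ.m∸n+n≡m i≤j))
  where
  go : ∀ d j → toℕ j ≡ d N.+ toℕ i → toℕ j N.< hi → f i ≤ f j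
  go zero j j≡i _ = ≤-reflexive (cong f (toℕ-injective (sym j≡i)))
  go (suc d) j j≡ j<hi =
    ≤-trans (go d j′ j′≡ j′<hi) (adjacent j′ j (trans (cong suc j′≡) (sym j≡)) lo≤j′ j<hi)
    where
    d+i<N : d N.+ toℕ i N.< N
    d+i<N = ℕ.<-trans (ℕ.n<1+n _) (subst (N._< N) j≡ (toℕ<n j))
    j′ = fromℕ< d+i<N
    j′≡ = toℕ-fromℕ< d+i<N
    j′<hi = subst (N._< hi) (sym j′≡) (ℕ.<-trans (ℕ.n<1+n _) (subst (N._< hi) j≡ j<hi))
    lo≤j′ = subst (lo N.≤_) (sym j′≡) (ℕ.≤-trans lo≤i (ℕ.m≤n+m _ d))

tabulate-adjacent : ∀ {A : Set} {N} (g g′ : Fin N → A) {a b : Fin N} → suc (toℕ a) ≡ toℕ b →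
  (∀ x → x ≢ a → x ≢ b → g x ≡ g′ x) →
  ∃[ rest ] (tabulate g ≡ take (toℕ a) (tabulate g) ++ g a ∷ g b ∷ rest)
          × (tabulate g′ ≡ take (toℕ a) (tabulate g) ++ g′ a ∷ g′ b ∷ rest)
tabulate-adjacent {N = suc (suc N)} g g′ {zero} {suc zero} refl agree =
  tabulate (λ x → g (suc (suc x))) , refl ,
  cong (λ rest → g′ zero ∷ g′ (suc zero) ∷ rest)
       (sym (tabulate-cong (λ x → agree (suc (suc x)) (λ ()) (λ ()))))
tabulate-adjacent {N = suc N} g g′ {suc a} {suc b} adj agree
  with tabulate-adjacent (g ∘ suc) (g′ ∘ suc) (ℕ.suc-injective adj)
         (λ x x≢a x≢b → agree (suc x) (x≢a ∘ suc-injective) (x≢b ∘ suc-injective))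
... | rest , eq , eq′ = rest , cong (g zero ∷_) eq , cong₂ _∷_ (sym (agree zero (λ ()) (λ ()))) eq′
tabulate-adjacent _ _ {zero} {zero} ()
tabulate-adjacent _ _ {zero} {suc (suc _)} ()
tabulate-adjacent _ _ {suc _} {zero} ()

transpose-left : ∀ {N} (i j : Fin N) → Components.transpose i j i ≡ j
transpose-left i j rewrite dec-true (i ≟ i) refl = refl

transpose-right : ∀ {N} (i j : Fin N) → Components.transpose i j j ≡ i
transpose-right i j with j ≟ i
... | yes j≡i = j≡i
... | no _ rewrite dec-true (j ≟ j) refl = refl

transpose-other : ∀ {N} {i j k : Fin N} → k ≢ i → k ≢ j → Components.transpose i j k ≡ k
transpose-other {i = i} {j} {k} k≢i k≢j rewrite dec-false (k ≟ i) k≢i | dec-false (k ≟ j) k≢j = refl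

module _ {n : ℕ} (I : Instance n) where
  open Instance I

  Step : Set
  Step = ℚ × Fin n

  levelAfter : ℚ → List Step → ℚ
  levelAfter L [] = L
  levelAfter L ((d , j) ∷ xs) = levelAfter ((L + d) - δ j) xs

  levelAfter-take : ∀ {N} L (g : Fin N → Step) j →
    levelAfter L (take j (tabulate g)) ≡ (L + prefixSum (proj₁ ∘ g) j) - prefixSum (δ ∘ proj₂ ∘ g) j
  levelAfter-take L g zero = solve 1 (λ L → L := (L :+ con 0ℚ) :- con 0ℚ) refl L
  levelAfter-take {zero} L g (suc j) = solve 1 (λ L → L := (L :+ con 0ℚ) :- con 0ℚ) refl L
  levelAfter-take {suc N} L g (suc j) =
    trans (levelAfter-take _ (g ∘ suc) j)
          (solve 5 (λ L d e D E → (((L :+ d) :- e) :+ D) :- E := (L :+ (d :+ D)) :- (e :+ E)) refl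
                 L (proj₁ (g zero)) (δ (proj₂ (g zero)))
                 (prefixSum (proj₁ ∘ g ∘ suc) j) (prefixSum (δ ∘ proj₂ ∘ g ∘ suc) j))

  feasibleFrom-replaceSuffix : ∀ L pre {ys ys′} →
    (feasibleFrom I (levelAfter L pre) ys → feasibleFrom I (levelAfter L pre) ys′) →
    feasibleFrom I L (pre ++ ys) → feasibleFrom I L (pre ++ ys′)
  feasibleFrom-replaceSuffix L [] replace = replace
  feasibleFrom-replaceSuffix L ((d , j) ∷ pre) replace (0≤d , d≤ , 0≤level , rest) =
    0≤d , d≤ , 0≤level , feasibleFrom-replaceSuffix _ pre replace rest

  sumCFrom-replaceSuffix-< : ∀ pre {ys ys′} → (∀ t → sumCFrom I t ys′ < sumCFrom I t ys) →
    ∀ t → sumCFrom I t (pre ++ ys′) < sumCFrom I t (pre ++ ys)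
  sumCFrom-replaceSuffix-< [] cheaper t = cheaper t
  sumCFrom-replaceSuffix-< ((d , j) ∷ pre) cheaper t =
    +-monoʳ-< ((t + d) + p j) (sumCFrom-replaceSuffix-< pre cheaper _)

  interchange : ℚ → Step → Step → List Step → List Step
  interchange L (da , ja) (db , jb) zs =
    (shortfall L (δ jb) , jb) ∷ ((da + db) - shortfall L (δ jb) , ja) ∷ zs

  feasibleFrom-interchange : ∀ L da ja db jb zs → db ≤ δ jb →
    feasibleFrom I L ((da , ja) ∷ (db , jb) ∷ zs) → feasibleFrom I L (interchange L (da , ja) (db , jb) zs)
  feasibleFrom-interchange L da ja db jb zs db≤B (0≤da , da≤ , _ , 0≤db , db≤ , 0≤ℓ₂ , rest) =
    p≤p⊔q 0ℚ (B - L) , q+p≤r⇒p≤r-q L+u≤Mx , 0≤L+u-B , p≤q⇒0≤q-p u≤da+db , q+p≤r⇒p≤r-q ℓ+v≤Mx ,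
    subst (0ℚ ≤_) (sym same-level) 0≤ℓ₂ , subst (λ ℓ → feasibleFrom I ℓ zs) (sym same-level) rest
    where
    A = δ ja
    B = δ jb
    u = shortfall L B
    L+u≡L⊔B : L + u ≡ L ⊔ B
    L+u≡L⊔B = +-shortfall L B
    L+u≤Mx : L + u ≤ MLmax
    L+u≤Mx = subst (_≤ MLmax) (sym L+u≡L⊔B)
      (⊔-lub (≤-trans (p≤p+q {L} 0≤da) (p≤r-q⇒q+p≤r da≤))
             (≤-trans (0≤q-p⇒p≤q 0≤ℓ₂) (p≤r-q⇒q+p≤r db≤)))
    0≤L+u-B : 0ℚ ≤ (L + u) - B
    0≤L+u-B = subst (λ x → 0ℚ ≤ x - B) (sym L+u≡L⊔B) (p≤q⇒0≤q-p (p≤q⊔p L B))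
    u≤da+db : u ≤ da + db
    u≤da+db = ⊔-lub (0≤p+q 0≤da 0≤db)
      (0≤q-p⇒p≤q (subst (0ℚ ≤_)
        (solve 5 (λ L da A db B → ((((L :+ da) :- A) :+ db) :- B) :+ A := (da :+ db) :- (B :- L))
                 refl L da A db B)
        (0≤p+q 0≤ℓ₂ (δ≥0 ja))))
    ℓ+v≤Mx : ((L + u) - B) + ((da + db) - u) ≤ MLmax
    ℓ+v≤Mx = ≤-trans
      (subst (_≤ L + da)
        (solve 5 (λ L da db B u → (L :+ da) :- (B :- db) := ((L :+ u) :- B) :+ ((da :+ db) :- u))
                 refl L da db B u)
        (p-q≤p (p≤q⇒0≤q-p db≤B)))
      (p≤r-q⇒q+p≤r da≤)
    same-level : (((L + u) - B) + ((da + db) - u)) - A ≡ (((L + da) - A) + db) - B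
    same-level = solve 6
      (λ L da A db B u → (((L :+ u) :- B) :+ ((da :+ db) :- u)) :- A := (((L :+ da) :- A) :+ db) :- B)
      refl L da A db B u

  sumCFrom-interchange-< : ∀ L da ja db jb zs → p jb + shortfall L (δ jb) < p ja + da →
    ∀ t → sumCFrom I t (interchange L (da , ja) (db , jb) zs) < sumCFrom I t ((da , ja) ∷ (db , jb) ∷ zs)
  sumCFrom-interchange-< L da ja db jb zs cheaper t =
    +-mono-<-≤ first-earlier (≤-reflexive (cong (λ c → c + sumCFrom I c zs) second-same))
    where
    u = shortfall L (δ jb)
    first-earlier : (t + u) + p jb < (t + da) + p ja
    first-earlier = subst₂ _<_
      (solve 3 (λ t u b → t :+ (b :+ u) := (t :+ u) :+ b) refl t u (p jb))
      (solve 3 (λ t da a → t :+ (a :+ da) := (t :+ da) :+ a) refl t da (p ja))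
      (+-monoʳ-< t cheaper)
    second-same : (((t + u) + p jb) + ((da + db) - u)) + p ja ≡ (((t + da) + p ja) + db) + p jb
    second-same = solve 6
      (λ t u b da db a → (((t :+ u) :+ b) :+ ((da :+ db) :- u)) :+ a := (((t :+ da) :+ a) :+ db) :+ b)
      refl t u (p jb) da db (p ja)

  stepAt : Schedule n → Fin n → Step
  stepAt S x = (Schedule.m S x , Schedule.π S ⟨$⟩ʳ x)

  steps-tabulate : ∀ S → steps I S ≡ tabulate (stepAt S)
  steps-tabulate S = map-tabulate id (stepAt S)

  prefix-allFin : ∀ (f : Fin n → ℚ) j → sumℚ I (take j (map f (allFin n))) ≡ prefixSum f j
  prefix-allFin f j = cong (λ xs → foldr _+_ 0ℚ (take j xs)) (map-tabulate id f)

  module _ (S : Schedule n) where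
    open Schedule S

    Pπ Δπ : Fin n → ℚ
    Pπ = P I S
    Δπ = Δ I S

    levelBefore : Fin n → ℚ
    levelBefore x = levelAfter ML₀ (take (toℕ x) (tabulate (stepAt S)))

    interchanged : Fin n → Fin n → ℚ → ℚ → Schedule n
    interchanged a b u v = record
      { π = transpose a b ∘ₚ π
      ; m = updateAt (updateAt m a (const u)) b (const v) }

    module _ {a b : Fin n} (adj : suc (toℕ a) ≡ toℕ b) (u v : ℚ) where
      private
        a≢b : a ≢ b
        a≢b a≡b = ℕ.1+n≢n (trans adj (cong toℕ (sym a≡b)))

      stepAt-interchanged-left : stepAt (interchanged a b u v) a ≡ (u , π ⟨$⟩ʳ b)
      stepAt-interchanged-left = cong₂ _,_
        (trans (updateAt-minimal a b _ a≢b) (updateAt-updates a m))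
        (cong (π ⟨$⟩ʳ_) (transpose-left a b))

      stepAt-interchanged-right : stepAt (interchanged a b u v) b ≡ (v , π ⟨$⟩ʳ a)
      stepAt-interchanged-right = cong₂ _,_
        (updateAt-updates b (updateAt m a (const u)))
        (cong (π ⟨$⟩ʳ_) (transpose-right a b))

      stepAt-interchanged-other : ∀ x → x ≢ a → x ≢ b → stepAt S x ≡ stepAt (interchanged a b u v) x
      stepAt-interchanged-other x x≢a x≢b = sym (cong₂ _,_
        (trans (updateAt-minimal x b _ x≢b) (updateAt-minimal x a m x≢a))
        (cong (π ⟨$⟩ʳ_) (transpose-other x≢a x≢b)))

      tabulate-interchanged :
        ∃[ rest ] (tabulate (stepAt S) ≡ take (toℕ a) (tabulate (stepAt S)) ++ stepAt S a ∷ stepAt S b ∷ rest)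
                × (tabulate (stepAt (interchanged a b u v))
                     ≡ take (toℕ a) (tabulate (stepAt S)) ++ (u , π ⟨$⟩ʳ b) ∷ (v , π ⟨$⟩ʳ a) ∷ rest)
      tabulate-interchanged with tabulate-adjacent _ _ adj stepAt-interchanged-other
      ... | rest , eq , eq′ = rest , eq ,
        trans eq′ (cong (λ block → take (toℕ a) (tabulate (stepAt S)) ++ block ++ rest)
                        (cong₂ (λ x y → x ∷ y ∷ []) stepAt-interchanged-left stepAt-interchanged-right))

    optimal-interchange : Optimal I S → ∀ {a b} → suc (toℕ a) ≡ toℕ b → m b ≤ Δπ b →
      Pπ a + m a ≤ Pπ b + shortfall (levelBefore a) (Δπ b)
    optimal-interchange (feasible , optimal) {a} {b} adj mb≤Δb = ≮⇒≥ not-cheaper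
      where
      u = shortfall (levelBefore a) (Δπ b)
      S′ = interchanged a b u ((m a + m b) - u)
      split = tabulate-interchanged adj u ((m a + m b) - u)
      pre = take (toℕ a) (tabulate (stepAt S))
      rest = proj₁ split
      steps-S : steps I S ≡ pre ++ stepAt S a ∷ stepAt S b ∷ rest
      steps-S = trans (steps-tabulate S) (proj₁ (proj₂ split))
      steps-S′ : steps I S′ ≡ pre ++ interchange (levelBefore a) (stepAt S a) (stepAt S b) rest
      steps-S′ = trans (steps-tabulate S′) (proj₂ (proj₂ split))
      feasible′ : Feasible I S′
      feasible′ = subst (feasibleFrom I ML₀) (sym steps-S′)
        (feasibleFrom-replaceSuffix ML₀ pre (feasibleFrom-interchange _ _ _ _ _ rest mb≤Δb)
          (subst (feasibleFrom I ML₀) steps-S feasible))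
      not-cheaper : ¬ (Pπ b + u < Pπ a + m a)
      not-cheaper cheaper = <-irrefl refl (<-≤-trans
        (subst₂ (λ xs ys → sumCFrom I 0ℚ xs < sumCFrom I 0ℚ ys) (sym steps-S′) (sym steps-S)
          (sumCFrom-replaceSuffix-< pre (sumCFrom-interchange-< _ _ _ _ _ rest cheaper) 0ℚ))
        (optimal S′ feasible′))

    module SeparatedSchedule (opt : Optimal I S) (minimal : MinimalMaintenance I S)
                             (k : Fin n) (sep : IsSeparation I S k) where
      cumulative : ℕ → ℚ
      cumulative = prefixSum Δπ

      slack : ℚ
      slack = ML₀ - prefixBefore I S Δπ k

      slack-cumulative : slack ≡ ML₀ - cumulative (toℕ k)
      slack-cumulative = cong (ML₀ -_) (prefix-allFin Δπ (toℕ k))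

      cumulative-suc : ∀ x → cumulative (suc (toℕ x)) ≡ cumulative (toℕ x) + Δπ x
      cumulative-suc = prefixSum-suc Δπ

      maintenance-cumulative : ∀ j → j N.≤ n → prefixSum m j ≡ shortfall ML₀ (cumulative j)
      maintenance-cumulative zero _ = sym (shortfall-≤ ML₀≥0)
      maintenance-cumulative (suc j) j<n =
        ∀-toℕ {P = λ j → prefixSum m (suc j) ≡ shortfall ML₀ (cumulative (suc j))}
          (λ x → trans (sym (prefix-allFin m (suc (toℕ x))))
                       (trans (minimal x) (cong (shortfall ML₀) (prefix-allFin Δπ (suc (toℕ x))))))
          j<n

      below-separation : ∀ {j} → j N.≤ toℕ k → cumulative j ≤ ML₀
      below-separation {zero} _ = ML₀≥0
      below-separation {suc j} j<k =
        ∀-toℕ {P = λ j → j N.< toℕ k → cumulative (suc j) ≤ ML₀}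
          (λ x x<k → subst (_≤ ML₀) (prefix-allFin Δπ (suc (toℕ x))) (proj₂ sep x x<k))
          (ℕ.<-≤-trans j<k (ℕ.<⇒≤ (toℕ<n k))) j<k

      above-separation : ∀ {j} → toℕ k N.< j → ML₀ < cumulative j
      above-separation k<j =
        <-≤-trans (subst (ML₀ <_) (prefix-allFin Δπ (suc (toℕ k))) (proj₁ sep))
                  (prefixSum-mono Δπ (λ x → δ≥0 _) k<j)

      levelBefore-cumulative : ∀ x → levelBefore x ≡ (ML₀ ⊔ cumulative (toℕ x)) - cumulative (toℕ x)
      levelBefore-cumulative x = begin
        levelBefore x
          ≡⟨ levelAfter-take ML₀ (stepAt S) (toℕ x) ⟩
        (ML₀ + prefixSum m (toℕ x)) - cumulative (toℕ x)
          ≡⟨ cong (λ c → (ML₀ + c) - cumulative (toℕ x)) (maintenance-cumulative _ (ℕ.<⇒≤ (toℕ<n x))) ⟩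
        (ML₀ + shortfall ML₀ (cumulative (toℕ x))) - cumulative (toℕ x)
          ≡⟨ cong (_- cumulative (toℕ x)) (+-shortfall ML₀ _) ⟩
        (ML₀ ⊔ cumulative (toℕ x)) - cumulative (toℕ x)
          ∎
        where open ≡-Reasoning

      levelBefore-below : ∀ {x} → toℕ x N.≤ toℕ k → levelBefore x ≡ ML₀ - cumulative (toℕ x)
      levelBefore-below {x} x≤k =
        trans (levelBefore-cumulative x) (cong (_- cumulative (toℕ x)) (p≥q⇒p⊔q≡p (below-separation x≤k)))

      levelBefore-above : ∀ {x} → toℕ k N.< toℕ x → levelBefore x ≡ 0ℚ
      levelBefore-above {x} k<x = trans (levelBefore-cumulative x)
        (trans (cong (_- cumulative (toℕ x)) (p≤q⇒p⊔q≡q (<⇒≤ (above-separation k<x))))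
               (+-inverseʳ (cumulative (toℕ x))))

      maintenance-at : ∀ x →
        m x ≡ shortfall ML₀ (cumulative (suc (toℕ x))) - shortfall ML₀ (cumulative (toℕ x))
      maintenance-at x = begin
        m x
          ≡⟨ solve 2 (λ M d → d := (M :+ d) :- M) refl (prefixSum m (toℕ x)) (m x) ⟩
        (prefixSum m (toℕ x) + m x) - prefixSum m (toℕ x)
          ≡⟨ cong (_- prefixSum m (toℕ x)) (sym (prefixSum-suc m x)) ⟩
        prefixSum m (suc (toℕ x)) - prefixSum m (toℕ x)
          ≡⟨ cong₂ _-_ (maintenance-cumulative _ (toℕ<n x)) (maintenance-cumulative _ (ℕ.<⇒≤ (toℕ<n x))) ⟩
        shortfall ML₀ (cumulative (suc (toℕ x))) - shortfall ML₀ (cumulative (toℕ x))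
          ∎
        where open ≡-Reasoning

      maintenance≤deterioration : ∀ x → m x ≤ Δπ x
      maintenance≤deterioration x = subst (_≤ Δπ x) (sym (maintenance-at x))
        (p≤q+r⇒p-q≤r (subst (λ c → shortfall ML₀ c ≤ shortfall ML₀ (cumulative (toℕ x)) + Δπ x)
                            (sym (cumulative-suc x))
                            (shortfall-+ ML₀ (cumulative (toℕ x)) (δ≥0 _))))

      maintenance-below : ∀ {x} → toℕ x N.< toℕ k → m x ≡ 0ℚ
      maintenance-below {x} x<k = trans (maintenance-at x)
        (trans (cong₂ _-_ (shortfall-≤ (below-separation x<k)) (shortfall-≤ (below-separation (ℕ.<⇒≤ x<k))))
               (+-inverseʳ 0ℚ))

      maintenance-separation : m k ≡ Δπ k - slack
      maintenance-separation = begin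
        m k
          ≡⟨ maintenance-at k ⟩
        shortfall ML₀ (cumulative (suc (toℕ k))) - shortfall ML₀ (cumulative (toℕ k))
          ≡⟨ cong₂ _-_ (shortfall-≥ (<⇒≤ (above-separation ℕ.≤-refl))) (shortfall-≤ (below-separation ℕ.≤-refl)) ⟩
        (cumulative (suc (toℕ k)) - ML₀) - 0ℚ
          ≡⟨ cong (λ c → (c - ML₀) - 0ℚ) (cumulative-suc k) ⟩
        ((cumulative (toℕ k) + Δπ k) - ML₀) - 0ℚ
          ≡⟨ solve 3 (λ c d M → ((c :+ d) :- M) :- con 0ℚ := d :- (M :- c)) refl (cumulative (toℕ k)) (Δπ k) ML₀ ⟩
        Δπ k - (ML₀ - cumulative (toℕ k))
          ≡⟨ cong (Δπ k -_) (sym slack-cumulative) ⟩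
        Δπ k - slack
          ∎
        where open ≡-Reasoning

      maintenance-above : ∀ {x} → toℕ k N.< toℕ x → m x ≡ Δπ x
      maintenance-above {x} k<x = begin
        m x
          ≡⟨ maintenance-at x ⟩
        shortfall ML₀ (cumulative (suc (toℕ x))) - shortfall ML₀ (cumulative (toℕ x))
          ≡⟨ cong₂ _-_ (shortfall-≥ (<⇒≤ (above-separation (ℕ.m<n⇒m<1+n k<x))))
                       (shortfall-≥ (<⇒≤ (above-separation k<x))) ⟩
        (cumulative (suc (toℕ x)) - ML₀) - (cumulative (toℕ x) - ML₀)
          ≡⟨ cong (λ c → (c - ML₀) - (cumulative (toℕ x) - ML₀)) (cumulative-suc x) ⟩
        ((cumulative (toℕ x) + Δπ x) - ML₀) - (cumulative (toℕ x) - ML₀)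
          ≡⟨ solve 3 (λ c d M → ((c :+ d) :- M) :- (c :- M) := d) refl (cumulative (toℕ x)) (Δπ x) ML₀ ⟩
        Δπ x
          ∎
        where open ≡-Reasoning

      interchange-inequality : ∀ {a b} → suc (toℕ a) ≡ toℕ b →
        Pπ a + m a ≤ Pπ b + shortfall (levelBefore a) (Δπ b)
      interchange-inequality adj = optimal-interchange opt adj (maintenance≤deterioration _)

      nondecreasing-before : ∀ {a b} → suc (toℕ a) ≡ toℕ b → toℕ b N.< toℕ k → Pπ a ≤ Pπ b
      nondecreasing-before {a} {b} adj b<k = begin
        Pπ a                                     ≡⟨ sym (+-identityʳ _) ⟩
        Pπ a + 0ℚ                                ≡⟨ cong (Pπ a +_) (sym (maintenance-below a<k)) ⟩
        Pπ a + m a                               ≤⟨ interchange-inequality adj ⟩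
        Pπ b + shortfall (levelBefore a) (Δπ b)  ≡⟨ cong (Pπ b +_) (shortfall-≤ Δb≤level) ⟩
        Pπ b + 0ℚ                                ≡⟨ +-identityʳ _ ⟩
        Pπ b                                     ∎
        where
        open ≤-Reasoning
        a<k : toℕ a N.< toℕ k
        a<k = ℕ.<-trans (subst (toℕ a N.<_) adj (ℕ.n<1+n _)) b<k
        Δb≤level : Δπ b ≤ levelBefore a
        Δb≤level = subst (Δπ b ≤_) (sym (levelBefore-below (ℕ.<⇒≤ a<k))) (q+p≤r⇒p≤r-q (begin
          cumulative (toℕ a) + Δπ b            ≤⟨ +-monoˡ-≤ (Δπ b) (p≤p+q {cumulative (toℕ a)} (δ≥0 _)) ⟩
          (cumulative (toℕ a) + Δπ a) + Δπ b   ≡⟨ cong (_+ Δπ b) (sym (cumulative-suc a)) ⟩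
          cumulative (suc (toℕ a)) + Δπ b      ≡⟨ cong (λ j → cumulative j + Δπ b) adj ⟩
          cumulative (toℕ b) + Δπ b            ≡⟨ sym (cumulative-suc b) ⟩
          cumulative (suc (toℕ b))             ≤⟨ below-separation b<k ⟩
          ML₀                                  ∎))

      nondecreasing-after : ∀ {a b} → suc (toℕ a) ≡ toℕ b → toℕ k N.< toℕ a → Pπ a + Δπ a ≤ Pπ b + Δπ b
      nondecreasing-after {a} {b} adj k<a = begin
        Pπ a + Δπ a                              ≡⟨ cong (Pπ a +_) (sym (maintenance-above k<a)) ⟩
        Pπ a + m a                               ≤⟨ interchange-inequality adj ⟩
        Pπ b + shortfall (levelBefore a) (Δπ b)  ≡⟨ cong (λ ℓ → Pπ b + shortfall ℓ (Δπ b)) (levelBefore-above k<a) ⟩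
        Pπ b + shortfall 0ℚ (Δπ b)               ≡⟨ cong (Pπ b +_) shortfall-at-0 ⟩
        Pπ b + Δπ b                              ∎
        where
        open ≤-Reasoning
        shortfall-at-0 : shortfall 0ℚ (Δπ b) ≡ Δπ b
        shortfall-at-0 = trans (shortfall-≥ (δ≥0 _)) (solve 1 (λ d → d :- con 0ℚ := d) refl (Δπ b))

      just-before-separation : ∀ {i} → suc (toℕ i) ≡ toℕ k →
        Pπ i + (Δπ i ⊓ (Δπ k - slack)) ≤ Pπ k + (Δπ k - slack)
      just-before-separation {i} adj = begin
        Pπ i + (Δπ i ⊓ e)                                    ≡⟨ cong (_+ (Δπ i ⊓ e)) P≡P+m ⟩
        (Pπ i + m i) + (Δπ i ⊓ e)                            ≤⟨ +-monoˡ-≤ (Δπ i ⊓ e) (interchange-inequality adj) ⟩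
        (Pπ k + shortfall (levelBefore i) (Δπ k)) + (Δπ i ⊓ e) ≡⟨ cong (λ s → (Pπ k + s) + (Δπ i ⊓ e)) shortfall≡ ⟩
        (Pπ k + shortfall (Δπ i) e) + (Δπ i ⊓ e)             ≡⟨ +-assoc (Pπ k) _ _ ⟩
        Pπ k + (shortfall (Δπ i) e + (Δπ i ⊓ e))             ≡⟨ cong (Pπ k +_) (shortfall-+-⊓ (Δπ i) e) ⟩
        Pπ k + e                                             ∎
        where
        open ≤-Reasoning
        e = Δπ k - slack
        i<k : toℕ i N.< toℕ k
        i<k = subst (toℕ i N.<_) adj (ℕ.n<1+n _)
        P≡P+m : Pπ i ≡ Pπ i + m i
        P≡P+m = trans (sym (+-identityʳ _)) (cong (Pπ i +_) (sym (maintenance-below i<k)))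
        level≡ : levelBefore i ≡ slack + Δπ i
        level≡ = begin-equality
          levelBefore i                                  ≡⟨ levelBefore-below (ℕ.<⇒≤ i<k) ⟩
          ML₀ - cumulative (toℕ i)                       ≡⟨ solve 3 (λ M c d → M :- c := (M :- (c :+ d)) :+ d)
                                                                  refl ML₀ (cumulative (toℕ i)) (Δπ i) ⟩
          (ML₀ - (cumulative (toℕ i) + Δπ i)) + Δπ i     ≡⟨ cong (λ c → (ML₀ - c) + Δπ i) (sym (cumulative-suc i)) ⟩
          (ML₀ - cumulative (suc (toℕ i))) + Δπ i        ≡⟨ cong (λ j → (ML₀ - cumulative j) + Δπ i) adj ⟩
          (ML₀ - cumulative (toℕ k)) + Δπ i              ≡⟨ cong (_+ Δπ i) (sym slack-cumulative) ⟩
          slack + Δπ i                                   ∎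
        shortfall≡ : shortfall (levelBefore i) (Δπ k) ≡ shortfall (Δπ i) e
        shortfall≡ = trans (cong (λ ℓ → shortfall ℓ (Δπ k)) level≡)
          (cong (0ℚ ⊔_) (solve 3 (λ s d D → D :- (s :+ d) := (D :- s) :- d) refl slack (Δπ i) (Δπ k)))

      just-after-separation : ∀ {i} → toℕ i ≡ suc (toℕ k) →
        Pπ k + (Δπ k - slack) ≤ Pπ i + (0ℚ ⊔ (Δπ i - slack))
      just-after-separation {i} adj = begin
        Pπ k + (Δπ k - slack)                    ≡⟨ cong (Pπ k +_) (sym maintenance-separation) ⟩
        Pπ k + m k                               ≤⟨ interchange-inequality (sym adj) ⟩
        Pπ i + shortfall (levelBefore k) (Δπ i)  ≡⟨ cong (λ ℓ → Pπ i + shortfall ℓ (Δπ i)) level≡slack ⟩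
        Pπ i + shortfall slack (Δπ i)            ∎
        where
        open ≤-Reasoning
        level≡slack : levelBefore k ≡ slack
        level≡slack = trans (levelBefore-below ℕ.≤-refl) (sym slack-cumulative)

lemma2 : {n : ℕ} (I : Instance n) (S : Schedule n) (k : Fin n) →
  Optimal I S → MinimalMaintenance I S → IsSeparation I S k →
  let P = P I S
      Δ = Δ I S
      δ = Instance.ML₀ I - prefixBefore I S Δ k
  in
  (∀ i j → toℕ i N.≤ toℕ j → toℕ j N.< toℕ k → P i ≤ P j)
  × (∀ i j → toℕ k N.< toℕ i → toℕ i N.≤ toℕ j → P i + Δ i ≤ P j + Δ j)
  × (∀ i → suc (toℕ i) ≡ toℕ k → P i + (Δ i ⊓ (Δ k - δ)) ≤ P k + (Δ k - δ))
  × (∀ i → toℕ i ≡ suc (toℕ k) → P k + (Δ k - δ) ≤ P i + (0ℚ ⊔ (Δ i - δ)))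
lemma2 {n} I S k opt minimal sep =
    (λ i j → monotone-from-adjacent (Pπ I S) 0 (toℕ k)
               (λ _ _ adj _ b<k → nondecreasing-before adj b<k) i j z≤n)
  , (λ i j k<i i≤j → monotone-from-adjacent (λ x → Pπ I S x + Δπ I S x) (suc (toℕ k)) n
               (λ _ _ adj k<a _ → nondecreasing-after adj k<a) i j k<i i≤j (toℕ<n j))
  , (λ _ → just-before-separation)
  , (λ _ → just-after-separation)
  where open SeparatedSchedule I S opt minimal k sep
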